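{- Let $X$ be a topological space. If ${\sf NW}(\Omega_X,\Omega_X)$ holds, then for all positive integers $n$ and $k$, $\Omega_X\rightarrow(\Omega_X)^n_k$.
   Context: An $\omega$-cover of $X$ is an open cover $\mathcal{U}$ with $X\notin\mathcal{U}$ such that each finite subset of $X$ lies in some member of $\mathcal{U}$; $\Omega_X$ is the set of $\omega$-covers. $[S]^{\aleph_0}$, $[S]^{<\aleph_0}$, $[S]^n$ denote the countably infinite, the finite, and the $n$-element subsets of $S$. For a countably infinite $A$ fix a bijective enumeration $A=\{a_n:n\in\mathbb{N}\}$; for $s,T\subseteq A$, $s<T$ means $a_n\in s$, $a_m\in T$ imply $n<m$; a finite $s\subseteq C$ is an initial segment of $C\subseteq A$ if $s<C\setminus s$. A family $\mathcal{T}\subseteq[A]^{<\aleph_0}$ is thin if no element of $\mathcal{T}$ is an initial segment of another element of $\mathcal{T}$. ${\sf NW}(\Omega_X,\Omega_X)$: for every countably infinite $A\in\Omega_X$, every thin $\mathcal{T}\subseteq[A]^{<\aleph_0}$, every positive integer $n$ and every partition $\mathcal{T}=\mathcal{T}_1\cup\cdots\cup\mathcal{T}_n$ there are $B\in[A]^{\aleph_0}\cap\Omega_X$ and $i$ with $[B]^{<\aleph_0}\cap\mathcal{T}\subseteq\mathcal{T}_i$. $\Omega_X\rightarrow(\Omega_X)^n_k$: for every countable $A\in\Omega_X$ and every $f:[A]^n\to\{1,\dots,k\}$ there are $B\in[A]^{\aleph_0}\cap\Omega_X$ and $i\in\{1,\dots,k\}$ such that $f$ has value $i$ on all of $[B]^n$.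 -}

module Defs where

open import Data.Nat using (ℕ; _<_; _≤_)
open import Data.Fin using (Fin)
open import Data.Unit using (⊤)
open import Data.Product using (Σ; _×_; ∃)
open import Data.List using (List; length)
open import Data.List.Relation.Unary.All using (All)
open import Data.List.Relation.Unary.Linked using (Linked)
open import Data.List.Membership.Propositional using (_∈_)
open import Relation.Nullary using (¬_)
open import Relation.Binary.PropositionalEquality using (_≡_)

Subset : Set → Set₁
Subset X = X → Set

_≐_ : {X : Set} → Subset X → Subset X → Set
U ≐ V = ∀ x → (U x → V x) × (V x → U x)

record Topology (X : Set) : Set₁ where
  field
    Open      : Subset X → Set
    open-ext  : ∀ U V → U ≐ V → Open U → Open V
    open-univ : Open (λ _ → ⊤)
    open-∩    : ∀ U V → Open U → Open V → Open (λ x → U x × V x)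
    open-⋃    : (I : Set) (U : I → Subset X) → (∀ i → Open (U i)) →
                Open (λ x → Σ I (λ i → U i x))
open Topology public

-- A countably infinite family of subsets of X, given by a bijective
-- enumeration a : ℕ → Subset X (injective up to equality of sets).
-- Subfamilies of {a n : n ∈ ℕ} are described by predicates on indices.
InjEnum : (X : Set) → Set₁
InjEnum X = Σ (ℕ → Subset X) (λ a → ∀ m n → a m ≐ a n → m ≡ n)

Infinite : (ℕ → Set) → Set
Infinite P = ∀ m → ∃ (λ k → m ≤ k × P k)

IsωCover : {X : Set} → Topology X → (ℕ → Subset X) → (ℕ → Set) → Set
IsωCover {X} τ a P =
  (∀ m → P m → Open τ (a m)) ×
  (∀ m → P m → ¬ (a m ≐ (λ _ → ⊤))) ×
  (∀ (F : List X) → ∃ (λ m → P m × All (a m) F))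

-- Finite subsets of the index set ℕ are represented canonically by strictly
-- increasing lists.
StrictIncr : List ℕ → Set
StrictIncr = Linked _<_

IsInitialSegment : List ℕ → List ℕ → Set
IsInitialSegment s C =
  (∀ x → x ∈ s → x ∈ C) ×
  (∀ x y → x ∈ s → y ∈ C → ¬ (y ∈ s) → x < y)

Thin : (List ℕ → Set) → Set
Thin T = (∀ s → T s → StrictIncr s) ×
         (∀ s t → T s → T t → IsInitialSegment s t → s ≡ t)

-- NW(Ω_X, Ω_X). A partition T = T₁ ∪ … ∪ Tₙ is given by a colouring c into Fin n.
NW : {X : Set} → Topology X → Set₁
NW {X} τ =
  ∀ (A : InjEnum X) → IsωCover τ (Σ.proj₁ A) (λ _ → ⊤) →
  ∀ (T : List ℕ → Set) → Thin T →
  ∀ (n : ℕ) → 1 ≤ n → (c : List ℕ → Fin n) →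
  Σ (ℕ → Set) (λ B → Infinite B × IsωCover τ (Σ.proj₁ A) B ×
    ∃ (λ (i : Fin n) → ∀ s → StrictIncr s → All B s → T s → c s ≡ i))

-- Ω_X → (Ω_X)^n_k. Colours {1,…,k} are Fin k; f : [A]^n → Fin k is given by
-- its values on strictly increasing lists of length n.
Ramsey : {X : Set} → Topology X → ℕ → ℕ → Set₁
Ramsey {X} τ n k =
  ∀ (A : InjEnum X) → IsωCover τ (Σ.proj₁ A) (λ _ → ⊤) →
  ∀ (f : List ℕ → Fin k) →
  Σ (ℕ → Set) (λ B → Infinite B × IsωCover τ (Σ.proj₁ A) B ×
    ∃ (λ (i : Fin k) → ∀ s → StrictIncr s → length s ≡ n → All B s → f s ≡ i))

module Submission where

open import Defs
open import Data.Nat using (ℕ; _≤_; _<_)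
open import Data.Nat.Properties using (<-trans; <-irrefl; <-asym; suc-injective)
open import Data.Product using (_×_; _,_; proj₁)
open import Data.List using (List; []; _∷_; length)
open import Data.List.Relation.Unary.All using (lookup)
open import Data.List.Relation.Unary.AllPairs using (_∷_)
open import Data.List.Relation.Unary.Any using (here; there)
open import Data.List.Relation.Unary.Linked using () renaming (tail to Linked-tail)
open import Data.List.Relation.Unary.Linked.Properties using (Linked⇒AllPairs)
open import Data.List.Membership.Propositional using (_∈_)
open import Data.Empty using (⊥-elim)
open import Relation.Nullary using (¬_)
open import Relation.Binary.PropositionalEquality using (_≡_; refl; sym; trans; cong)

ExactSize : ℕ → List ℕ → Set
ExactSize n s = StrictIncr s × length s ≡ n

head<members : ∀ {x s z} → StrictIncr (x ∷ s) → z ∈ s → x < z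
head<members incr z∈s with Linked⇒AllPairs <-trans incr
... | x<s ∷ _ = lookup x<s z∈s

initialSegment-head-≡ : ∀ {x y s t} → StrictIncr (x ∷ s) → StrictIncr (y ∷ t) →
                        IsInitialSegment (x ∷ s) (y ∷ t) → x ≡ y
initialSegment-head-≡ {x} {y} {s} incrₛ incrₜ (sub , below) with sub x (here refl)
... | here x≡y  = x≡y
... | there x∈t = ⊥-elim (<-asym y<x (below x y (here refl) (here refl) y∉x∷s))
  where
  y<x : y < x
  y<x = head<members incrₜ x∈t
  y∉x∷s : ¬ (y ∈ x ∷ s)
  y∉x∷s (here y≡x)  = <-irrefl y≡x y<x
  y∉x∷s (there y∈s) = <-asym y<x (head<members incrₛ y∈s)

initialSegment-tail : ∀ {x s t} → StrictIncr (x ∷ s) → StrictIncr (x ∷ t) →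
                      IsInitialSegment (x ∷ s) (x ∷ t) → IsInitialSegment s t
initialSegment-tail {x} {s} {t} incrₛ incrₜ (sub , below) = sub′ , below′
  where
  sub′ : ∀ z → z ∈ s → z ∈ t
  sub′ z z∈s with sub z (there z∈s)
  ... | here z≡x  = ⊥-elim (<-irrefl (sym z≡x) (head<members incrₛ z∈s))
  ... | there z∈t = z∈t
  below′ : ∀ z w → z ∈ s → w ∈ t → ¬ (w ∈ s) → z < w
  below′ z w z∈s w∈t w∉s = below z w (there z∈s) (there w∈t) w∉x∷s
    where
    w∉x∷s : ¬ (w ∈ x ∷ s)
    w∉x∷s (here w≡x)  = <-irrefl (sym w≡x) (head<members incrₜ w∈t)
    w∉x∷s (there w∈s) = w∉s w∈s

initialSegment-sameLength⇒≡ : ∀ {s t} → StrictIncr s → StrictIncr t →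
                              length s ≡ length t → IsInitialSegment s t → s ≡ t
initialSegment-sameLength⇒≡ {[]}    {[]}    _     _     _   _   = refl
initialSegment-sameLength⇒≡ {x ∷ s} {y ∷ t} incrₛ incrₜ len seg
  with initialSegment-head-≡ incrₛ incrₜ seg
... | refl = cong (x ∷_) (initialSegment-sameLength⇒≡ (Linked-tail incrₛ) (Linked-tail incrₜ)
                            (suc-injective len) (initialSegment-tail incrₛ incrₜ seg))

exactSize-thin : ∀ n → Thin (ExactSize n)
exactSize-thin n = (λ _ → proj₁) , λ _ _ (incrₛ , lenₛ) (incrₜ , lenₜ) →
  initialSegment-sameLength⇒≡ incrₛ incrₜ (trans lenₛ (sym lenₜ))

-- A colouring of [A]^n is a partition of the thin family [A]^n into k pieces.
theorem9 : (X : Set) (τ : Topology X) → NW τ →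
    ∀ (n k : ℕ) → 1 ≤ n → 1 ≤ k → Ramsey τ n k
theorem9 X τ nw n k _ k≥1 A cover f
  with nw A cover (ExactSize n) (exactSize-thin n) k k≥1 f
... | B , infinite , coverB , i , monochromatic =
  B , infinite , coverB , i , λ s incr len s⊆B → monochromatic s incr s⊆B (incr , len)
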